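{- For every integer $n \ge 3$, $|\Lambda_{n}| \ge \frac{n!}{8}$, where $\Lambda_n$ is the set of permutations in $\mathfrak{S}_{n}$ having no orbit of length $1$ or $2$. -}

module Defs where

open import Data.Nat using (ℕ)
open import Data.Fin using (Fin)
open import Data.Fin.Permutation using (Permutation′; _⟨$⟩ʳ_)
open import Data.List using (List)
open import Data.List.Relation.Unary.All using (All)
open import Data.List.Relation.Unary.AllPairs using (AllPairs)
open import Relation.Binary.PropositionalEquality using (_≡_; _≢_)
open import Relation.Nullary using (¬_)

-- π has no orbit of length 1 (fixed point) or 2 (i with π i ≠ i, π (π i) = i).
-- Since fixed points are excluded, orbits of length 2 are exactly points with π (π i) = i.
NoShortOrbit : {n : ℕ} → Permutation′ n → Set
NoShortOrbit {n} π = (i : Fin n) → (π ⟨$⟩ʳ i ≢ i) × (π ⟨$⟩ʳ (π ⟨$⟩ʳ i) ≢ i)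
  where open import Data.Product using (_×_)

SamePerm : {n : ℕ} → Permutation′ n → Permutation′ n → Set
SamePerm {n} π σ = (i : Fin n) → π ⟨$⟩ʳ i ≡ σ ⟨$⟩ʳ i

DistinctInΛ : {n : ℕ} → List (Permutation′ n) → Set
DistinctInΛ ps = AllPairs (λ π σ → ¬ SamePerm π σ) ps × All NoShortOrbit ps
  where open import Data.Product using (_×_)

{-# OPTIONS --safe #-}
-- Every π ∈ Λₙ₋₁ yields n − 1 elements of Λₙ by inserting the new point n
-- into a cycle of π right after one of its points, and every π ∈ Λₙ₋₃
-- yields (n − 1)(n − 2) elements of Λₙ by adding a 3-cycle through n.
-- All of these are distinct, since n lies on a 3-cycle exactly in the
-- second case, so |Λₙ| ≥ (n − 1) |Λₙ₋₁| + (n − 1)(n − 2) |Λₙ₋₃|.  As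
-- n! = (n − 1) (n − 1)! + (n − 1)(n − 2) (n − 3)!, the bound 8 |Λₙ| ≥ n!
-- propagates by induction from n = 3, 4, 5.
module Submission where

open import Defs
open import Data.Nat using (ℕ; zero; suc; _+_; _*_; _≤_; _≥_; s≤s; _!)
open import Data.Nat.Properties using (≤ᵇ⇒≤; +-comm; *-assoc; +-mono-≤; *-monoʳ-≤; module ≤-Reasoning)
open import Data.Nat.Tactic.RingSolver using (solve-∀)
open import Data.Fin using (Fin; zero; suc; punchIn; punchOut; _≟_)
open import Data.Fin.Properties using (punchIn-injective; punchInᵢ≢i; punchIn-punchOut; suc-injective)
open import Data.Fin.Permutation
  using (Permutation; Permutation′; _⟨$⟩ʳ_; _≈_; id; transpose; insert; _∘ₚ_; insert-punchIn)
import Data.Fin.Permutation.Components as PC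
open import Data.List
  using (List; []; _∷_; _++_; length; map; allFin; cartesianProduct; cartesianProductWith)
open import Data.List.Properties using (length-++; length-map; length-tabulate)
open import Data.List.Relation.Unary.All as All using (All; []; _∷_)
import Data.List.Relation.Unary.All.Properties as All
open import Data.List.Relation.Unary.AllPairs using ([]; _∷_)
import Data.List.Relation.Unary.AllPairs.Properties as AllPairs
open import Data.List.Relation.Unary.Unique.Setoid using (Unique)
import Data.List.Relation.Unary.Unique.Setoid.Properties as Unique
open import Data.List.Relation.Unary.Unique.Propositional.Properties using (allFin⁺)
open import Data.Product using (Σ; _×_; _,_; proj₁; proj₂; uncurry)
open import Data.Product.Relation.Binary.Pointwise.NonDependent using (_×ₛ_)
open import Function using (_∘_; Injection)
open import Function.Properties.Inverse using (↔⇒↣)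
open import Level using (0ℓ)
open import Relation.Binary.Bundles using (Setoid)
open import Relation.Nullary using (¬_; yes; no)
open import Relation.Nullary.Decidable using (dec-true; dec-false; dec-yes)
open import Relation.Binary.PropositionalEquality
  using (_≡_; _≢_; refl; sym; trans; cong; cong₂; subst; setoid; module ≡-Reasoning)

private
  variable
    m n : ℕ

module _ {A B C : Set} where

  length-cartesianProductWith : (f : A → B → C) (xs : List A) (ys : List B) →
                                length (cartesianProductWith f xs ys) ≡ length xs * length ys
  length-cartesianProductWith f []       ys = refl
  length-cartesianProductWith f (x ∷ xs) ys = trans (length-++ (map (f x) ys))
    (cong₂ _+_ (length-map (f x) ys) (length-cartesianProductWith f xs ys))

  All-cartesianProductWith : {P : B → Set} {Q : C → Set} (f : A → B → C) (xs : List A) {ys : List B} →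
                             (∀ x {y} → P y → Q (f x y)) → All P ys → All Q (cartesianProductWith f xs ys)
  All-cartesianProductWith f xs {ys} pres Pys =
    All.cartesianProductWith⁺ (setoid A) (setoid B) f xs ys (λ {x} _ y∈ys → pres x (All.lookup Pys y∈ys))

length-allFin : (n : ℕ) → length (allFin n) ≡ n
length-allFin n = length-tabulate (λ i → i)

permutationSetoid : ℕ → Setoid 0ℓ 0ℓ
permutationSetoid n = record
  { Carrier       = Permutation′ n
  ; _≈_           = _≈_
  ; isEquivalence = record
    { refl  = λ _ → refl
    ; sym   = λ π≈ρ i → sym (π≈ρ i)
    ; trans = λ π≈ρ ρ≈τ i → trans (π≈ρ i) (ρ≈τ i)
    }
  }

⟨$⟩ʳ-injective : (π : Permutation′ n) {x y : Fin n} → π ⟨$⟩ʳ x ≡ π ⟨$⟩ʳ y → x ≡ y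
⟨$⟩ʳ-injective π = Injection.injective (↔⇒↣ π)

transpose-matchˡ : (i j : Fin n) → PC.transpose i j i ≡ j
transpose-matchˡ i j rewrite dec-true (i ≟ i) refl = refl

transpose-matchʳ : (i j : Fin n) → PC.transpose i j j ≡ i
transpose-matchʳ i j with j ≟ i
... | yes j≡i = j≡i
... | no _ rewrite dec-true (j ≟ j) refl = refl

transpose-other : {i j k : Fin n} → k ≢ i → k ≢ j → PC.transpose i j k ≡ k
transpose-other {i = i} {j} {k} k≢i k≢j
  rewrite dec-false (k ≟ i) k≢i | dec-false (k ≟ j) k≢j = refl

insert-at : (i : Fin (suc m)) (j : Fin (suc n)) (π : Permutation m n) → insert i j π ⟨$⟩ʳ i ≡ j
insert-at i j π rewrite proj₂ (dec-yes (i ≟ i) refl) = refl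

insert-injective : {i : Fin (suc m)} {j : Fin (suc n)} {π ρ : Permutation m n} →
                   insert i j π ≈ insert i j ρ → π ≈ ρ
insert-injective {i = i} {j} {π} {ρ} π≈ρ k = punchIn-injective j _ _ (begin
  punchIn j (π ⟨$⟩ʳ k)          ≡⟨ insert-punchIn i j π k ⟨
  insert i j π ⟨$⟩ʳ punchIn i k ≡⟨ π≈ρ (punchIn i k) ⟩
  insert i j ρ ⟨$⟩ʳ punchIn i k ≡⟨ insert-punchIn i j ρ k ⟩
  punchIn j (ρ ⟨$⟩ʳ k)          ∎)
  where open ≡-Reasoning

data PunchInView (p : Fin (suc n)) : Fin (suc n) → Set where
  pivot   : PunchInView p p
  punched : (y : Fin n) → PunchInView p (punchIn p y)

punchInView : (p x : Fin (suc n)) → PunchInView p x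
punchInView p x with p ≟ x
... | yes refl = pivot
... | no p≢x   = subst (PunchInView p) (punchIn-punchOut p≢x) (punched (punchOut p≢x))

noShortOrbitAt : (π : Permutation′ n) {x y z : Fin n} →
                 π ⟨$⟩ʳ x ≡ y → π ⟨$⟩ʳ y ≡ z → y ≢ x → z ≢ x →
                 π ⟨$⟩ʳ x ≢ x × π ⟨$⟩ʳ (π ⟨$⟩ʳ x) ≢ x
noShortOrbitAt π x↦y y↦z y≢x z≢x =
  y≢x ∘ trans (sym x↦y) , z≢x ∘ trans (sym (trans (cong (π ⟨$⟩ʳ_) x↦y) y↦z))

ThreePeriodic : Permutation′ n → Fin n → Set
ThreePeriodic π x = π ⟨$⟩ʳ (π ⟨$⟩ʳ (π ⟨$⟩ʳ x)) ≡ x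

ThreePeriodic-separates : {π ρ : Permutation′ n} {x : Fin n} →
                          ¬ ThreePeriodic π x → ThreePeriodic ρ x → ¬ π ≈ ρ
ThreePeriodic-separates {π = π} {ρ} {x} ¬π³x≡x ρ³x≡x π≈ρ = ¬π³x≡x (begin
  π ⟨$⟩ʳ (π ⟨$⟩ʳ (π ⟨$⟩ʳ x)) ≡⟨ cong (λ y → π ⟨$⟩ʳ (π ⟨$⟩ʳ y)) (π≈ρ x) ⟩
  π ⟨$⟩ʳ (π ⟨$⟩ʳ (ρ ⟨$⟩ʳ x)) ≡⟨ cong (π ⟨$⟩ʳ_) (π≈ρ _) ⟩
  π ⟨$⟩ʳ (ρ ⟨$⟩ʳ (ρ ⟨$⟩ʳ x)) ≡⟨ π≈ρ _ ⟩
  ρ ⟨$⟩ʳ (ρ ⟨$⟩ʳ (ρ ⟨$⟩ʳ x)) ≡⟨ ρ³x≡x ⟩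
  x                          ∎)
  where open ≡-Reasoning

-- Adding p as a fixed point and then precomposing with the transposition of
-- p and (the shifted) i splices p into the cycle of i, right after i.
opaque
  insertAfter : Fin (suc m) → Fin m → Permutation′ m → Permutation′ (suc m)
  insertAfter p i σ = transpose p (punchIn p i) ∘ₚ insert p p σ

module _ (p : Fin (suc m)) (i : Fin m) (σ : Permutation′ m) where

  private
    π = insertAfter p i σ

  opaque
    unfolding insertAfter

    insertAfter-new : π ⟨$⟩ʳ p ≡ punchIn p (σ ⟨$⟩ʳ i)
    insertAfter-new =
      trans (cong (insert p p σ ⟨$⟩ʳ_) (transpose-matchˡ p (punchIn p i))) (insert-punchIn p p σ i)

    insertAfter-anchor : π ⟨$⟩ʳ punchIn p i ≡ p
    insertAfter-anchor =
      trans (cong (insert p p σ ⟨$⟩ʳ_) (transpose-matchʳ p (punchIn p i))) (insert-at p p σ)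

    insertAfter-punchIn : {y : Fin m} → y ≢ i → π ⟨$⟩ʳ punchIn p y ≡ punchIn p (σ ⟨$⟩ʳ y)
    insertAfter-punchIn {y} y≢i = trans
      (cong (insert p p σ ⟨$⟩ʳ_) (transpose-other (punchInᵢ≢i p y) (y≢i ∘ punchIn-injective p y i)))
      (insert-punchIn p p σ y)

  insertAfter-NoShortOrbit : NoShortOrbit σ → NoShortOrbit π
  insertAfter-NoShortOrbit noσ x with punchInView p x
  ... | pivot = noShortOrbitAt π
    insertAfter-new (insertAfter-punchIn (proj₁ (noσ i)))
    (punchInᵢ≢i p _) (punchInᵢ≢i p _)
  ... | punched y with y ≟ i
  ...   | yes refl = noShortOrbitAt π
    insertAfter-anchor insertAfter-new
    (punchInᵢ≢i p i ∘ sym) (proj₁ (noσ i) ∘ punchIn-injective p _ _)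
  ...   | no y≢i with σ ⟨$⟩ʳ y ≟ i
  ...     | yes σy≡i = noShortOrbitAt π
    (insertAfter-punchIn y≢i) (trans (cong (λ z → π ⟨$⟩ʳ punchIn p z) σy≡i) insertAfter-anchor)
    (proj₁ (noσ y) ∘ punchIn-injective p _ _) (punchInᵢ≢i p y ∘ sym)
  ...     | no σy≢i = noShortOrbitAt π
    (insertAfter-punchIn y≢i) (insertAfter-punchIn σy≢i)
    (proj₁ (noσ y) ∘ punchIn-injective p _ _) (proj₂ (noσ y) ∘ punchIn-injective p _ _)

  insertAfter-¬ThreePeriodic : NoShortOrbit σ → ¬ ThreePeriodic π p
  insertAfter-¬ThreePeriodic noσ = punchInᵢ≢i p _ ∘ trans (sym (begin
    π ⟨$⟩ʳ (π ⟨$⟩ʳ (π ⟨$⟩ʳ p))            ≡⟨ cong (λ x → π ⟨$⟩ʳ (π ⟨$⟩ʳ x)) insertAfter-new ⟩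
    π ⟨$⟩ʳ (π ⟨$⟩ʳ punchIn p (σ ⟨$⟩ʳ i))   ≡⟨ cong (π ⟨$⟩ʳ_) (insertAfter-punchIn (proj₁ (noσ i))) ⟩
    π ⟨$⟩ʳ punchIn p (σ ⟨$⟩ʳ (σ ⟨$⟩ʳ i))   ≡⟨ insertAfter-punchIn (proj₂ (noσ i)) ⟩
    punchIn p (σ ⟨$⟩ʳ (σ ⟨$⟩ʳ (σ ⟨$⟩ʳ i))) ∎))
    where open ≡-Reasoning

insertAfter-injective : (p : Fin (suc m)) {i j : Fin m} {σ τ : Permutation′ m} →
                        insertAfter p i σ ≈ insertAfter p j τ → i ≡ j × σ ≈ τ
insertAfter-injective p {i} {j} {σ} {τ} π≈π′ with anchors-agree
  where
  anchors-agree : i ≡ j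
  anchors-agree = punchIn-injective p i j (⟨$⟩ʳ-injective (insertAfter p i σ) (begin
    insertAfter p i σ ⟨$⟩ʳ punchIn p i ≡⟨ insertAfter-anchor p i σ ⟩
    p                                 ≡⟨ insertAfter-anchor p j τ ⟨
    insertAfter p j τ ⟨$⟩ʳ punchIn p j ≡⟨ π≈π′ (punchIn p j) ⟨
    insertAfter p i σ ⟨$⟩ʳ punchIn p j ∎))
    where open ≡-Reasoning
... | refl = refl , σ≈τ
  where
  σ≈τ : σ ≈ τ
  σ≈τ y with y ≟ i
  ... | yes refl = punchIn-injective p _ _
    (trans (sym (insertAfter-new p i σ)) (trans (π≈π′ p) (insertAfter-new p i τ)))
  ... | no y≢i = punchIn-injective p _ _
    (trans (sym (insertAfter-punchIn p i σ y≢i)) (trans (π≈π′ (punchIn p y)) (insertAfter-punchIn p i τ y≢i)))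

-- The new points are 0, suc a and suc (punchIn a b), forming the cycle
-- 0 ↦ suc (punchIn a b) ↦ suc a ↦ 0.
addThreeCycle : Fin (suc (suc m)) → Fin (suc m) → Permutation′ m → Permutation′ (3 + m)
addThreeCycle a b σ = insertAfter zero a (insertAfter a b (insert b b σ))

module _ (a : Fin (suc (suc m))) (b : Fin (suc m)) (σ : Permutation′ m) where

  private
    σ̂ = insert b b σ
    ρ = insertAfter a b σ̂
    π = addThreeCycle a b σ

  addThreeCycle-zero : π ⟨$⟩ʳ zero ≡ suc (punchIn a b)
  addThreeCycle-zero = trans (insertAfter-new zero a ρ)
    (cong suc (trans (insertAfter-new a b σ̂) (cong (punchIn a) (insert-at b b σ))))

  addThreeCycle-second : π ⟨$⟩ʳ suc (punchIn a b) ≡ suc a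
  addThreeCycle-second =
    trans (insertAfter-punchIn zero a ρ (punchInᵢ≢i a b)) (cong suc (insertAfter-anchor a b σ̂))

  addThreeCycle-third : π ⟨$⟩ʳ suc a ≡ zero
  addThreeCycle-third = insertAfter-anchor zero a ρ

  addThreeCycle-old : (z : Fin m) →
                      π ⟨$⟩ʳ suc (punchIn a (punchIn b z)) ≡ suc (punchIn a (punchIn b (σ ⟨$⟩ʳ z)))
  addThreeCycle-old z = trans (insertAfter-punchIn zero a ρ (punchInᵢ≢i a _))
    (cong suc (trans (insertAfter-punchIn a b σ̂ (punchInᵢ≢i b z)) (cong (punchIn a) (insert-punchIn b b σ z))))

  addThreeCycle-ThreePeriodic : ThreePeriodic π zero
  addThreeCycle-ThreePeriodic = begin
    π ⟨$⟩ʳ (π ⟨$⟩ʳ (π ⟨$⟩ʳ zero))     ≡⟨ cong (λ x → π ⟨$⟩ʳ (π ⟨$⟩ʳ x)) addThreeCycle-zero ⟩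
    π ⟨$⟩ʳ (π ⟨$⟩ʳ suc (punchIn a b)) ≡⟨ cong (π ⟨$⟩ʳ_) addThreeCycle-second ⟩
    π ⟨$⟩ʳ suc a                      ≡⟨ addThreeCycle-third ⟩
    zero                              ∎
    where open ≡-Reasoning

  addThreeCycle-NoShortOrbit : NoShortOrbit σ → NoShortOrbit π
  addThreeCycle-NoShortOrbit noσ zero = noShortOrbitAt π
    addThreeCycle-zero addThreeCycle-second (λ ()) (λ ())
  addThreeCycle-NoShortOrbit noσ (suc x) with punchInView a x
  ... | pivot = noShortOrbitAt π
    addThreeCycle-third addThreeCycle-zero (λ ()) (punchInᵢ≢i a b ∘ suc-injective)
  ... | punched y with punchInView b y
  ...   | pivot = noShortOrbitAt π
    addThreeCycle-second addThreeCycle-third (punchInᵢ≢i a b ∘ sym ∘ suc-injective) (λ ())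
  ...   | punched z = noShortOrbitAt π
    (addThreeCycle-old z) (addThreeCycle-old (σ ⟨$⟩ʳ z))
    (proj₁ (noσ z) ∘ old-injective) (proj₂ (noσ z) ∘ old-injective)
    where
    old-injective : ∀ {u v} → suc (punchIn a (punchIn b u)) ≡ suc (punchIn a (punchIn b v)) → u ≡ v
    old-injective = punchIn-injective b _ _ ∘ punchIn-injective a _ _ ∘ suc-injective

addThreeCycle-injective : {a a′ : Fin (suc (suc m))} {b b′ : Fin (suc m)} {σ τ : Permutation′ m} →
                          addThreeCycle a b σ ≈ addThreeCycle a′ b′ τ → (a ≡ a′ × b ≡ b′) × σ ≈ τ
addThreeCycle-injective {b = b} π≈π′ with insertAfter-injective zero π≈π′
... | refl , ρ≈ρ′ with insertAfter-injective _ ρ≈ρ′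
...   | refl , σ̂≈τ̂ = (refl , refl) , insert-injective {i = b} {j = b} σ̂≈τ̂

insertions : (k : ℕ) → List (Permutation′ k) → List (Permutation′ (suc k))
insertions k = cartesianProductWith (insertAfter zero) (allFin k)

threeCyclePositions : (k : ℕ) → List (Fin (2 + k) × Fin (1 + k))
threeCyclePositions k = cartesianProduct (allFin (2 + k)) (allFin (1 + k))

threeCycleExtensions : (k : ℕ) → List (Permutation′ k) → List (Permutation′ (3 + k))
threeCycleExtensions k = cartesianProductWith (uncurry addThreeCycle) (threeCyclePositions k)

Λ-list : (n : ℕ) → List (Permutation′ n)
Λ-list 0                   = id ∷ []
Λ-list 1                   = []
Λ-list 2                   = []
Λ-list (suc (suc (suc k))) = insertions (2 + k) (Λ-list (suc (suc k))) ++ threeCycleExtensions k (Λ-list k)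

Λ-list-NoShortOrbit : (n : ℕ) → All NoShortOrbit (Λ-list n)
Λ-list-NoShortOrbit 0                   = (λ ()) ∷ []
Λ-list-NoShortOrbit 1                   = []
Λ-list-NoShortOrbit 2                   = []
Λ-list-NoShortOrbit (suc (suc (suc k))) = All.++⁺
  (All-cartesianProductWith (insertAfter zero) (allFin (2 + k))
    (λ i {σ} → insertAfter-NoShortOrbit zero i σ) (Λ-list-NoShortOrbit (suc (suc k))))
  (All-cartesianProductWith (uncurry addThreeCycle) (threeCyclePositions k)
    (λ (a , b) {σ} → addThreeCycle-NoShortOrbit a b σ) (Λ-list-NoShortOrbit k))

Λ-list-Unique : (n : ℕ) → Unique (permutationSetoid n) (Λ-list n)
Λ-list-Unique 0                   = [] ∷ []
Λ-list-Unique 1                   = []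
Λ-list-Unique 2                   = []
Λ-list-Unique (suc (suc (suc k))) = AllPairs.++⁺
  (Unique.cartesianProductWith⁺ (setoid (Fin (2 + k))) (permutationSetoid (2 + k)) (permutationSetoid (3 + k))
    (insertAfter zero) (insertAfter-injective zero)
    (allFin⁺ (2 + k)) (Λ-list-Unique (suc (suc k))))
  (Unique.cartesianProductWith⁺ (setoid (Fin (2 + k)) ×ₛ setoid (Fin (1 + k))) (permutationSetoid k) (permutationSetoid (3 + k))
    (uncurry addThreeCycle) addThreeCycle-injective
    (Unique.cartesianProduct⁺ (setoid (Fin (2 + k))) (setoid (Fin (1 + k))) (allFin⁺ (2 + k)) (allFin⁺ (1 + k)))
    (Λ-list-Unique k))
  (All.map (λ {π} ¬periodic → All.map (λ {ρ} → ThreePeriodic-separates {π = π} {ρ} ¬periodic) threeCycles-periodic)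
     insertions-aperiodic)
  where
  insertions-aperiodic : All (λ π → ¬ ThreePeriodic π zero) (insertions (2 + k) (Λ-list (2 + k)))
  insertions-aperiodic = All-cartesianProductWith (insertAfter zero) (allFin (2 + k))
    (λ i {σ} → insertAfter-¬ThreePeriodic zero i σ) (Λ-list-NoShortOrbit (suc (suc k)))

  threeCycles-periodic : All (λ π → ThreePeriodic π zero) (threeCycleExtensions k (Λ-list k))
  threeCycles-periodic = All.cartesianProductWith⁺ (setoid _) (setoid _)
    (uncurry addThreeCycle) (threeCyclePositions k) (Λ-list k)
    (λ {(a , b)} {σ} _ _ → addThreeCycle-ThreePeriodic a b σ)

Λ-list-length : (k : ℕ) → length (Λ-list (3 + k)) ≡
                (2 + k) * length (Λ-list (2 + k)) + (2 + k) * (1 + k) * length (Λ-list k)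
Λ-list-length k = begin
  length (ins ++ ext)     ≡⟨ length-++ ins ⟩
  length ins + length ext ≡⟨ cong₂ _+_ length-ins length-ext ⟩
  (2 + k) * length (Λ-list (2 + k)) + (2 + k) * (1 + k) * length (Λ-list k) ∎
  where
  open ≡-Reasoning
  ins = insertions (2 + k) (Λ-list (2 + k))
  ext = threeCycleExtensions k (Λ-list k)

  length-ins : length ins ≡ (2 + k) * length (Λ-list (2 + k))
  length-ins = trans (length-cartesianProductWith (insertAfter zero) (allFin (2 + k)) (Λ-list (2 + k)))
    (cong (_* length (Λ-list (2 + k))) (length-allFin (2 + k)))

  length-ext : length ext ≡ (2 + k) * (1 + k) * length (Λ-list k)
  length-ext = trans (length-cartesianProductWith (uncurry addThreeCycle) (threeCyclePositions k) (Λ-list k))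
    (cong (_* length (Λ-list k)) (trans (length-cartesianProductWith _,_ (allFin (2 + k)) (allFin (1 + k)))
                                        (cong₂ _*_ (length-allFin (2 + k)) (length-allFin (1 + k)))))

-- n! = (n − 1) (n − 1)! + (n − 1)!
factorial-recurrence : (k : ℕ) → (3 + k) ! ≡ (2 + k) * (2 + k) ! + (2 + k) * (1 + k) * k !
factorial-recurrence k = trans (+-comm ((2 + k) !) ((2 + k) * (2 + k) !))
  (cong ((2 + k) * (2 + k) ! +_) (sym (*-assoc (2 + k) (1 + k) (k !))))

Λ-list-large : (k : ℕ) → (3 + k) ! ≤ 8 * length (Λ-list (3 + k))
Λ-list-large 0 = ≤ᵇ⇒≤ _ _ _
Λ-list-large 1 = ≤ᵇ⇒≤ _ _ _
Λ-list-large 2 = ≤ᵇ⇒≤ _ _ _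
Λ-list-large k@(suc (suc (suc j))) = begin
  (3 + k) !                                       ≡⟨ factorial-recurrence k ⟩
  (2 + k) * (2 + k) ! + (2 + k) * (1 + k) * k !   ≤⟨ +-mono-≤ (*-monoʳ-≤ (2 + k) (Λ-list-large (suc (suc j))))
                                                              (*-monoʳ-≤ ((2 + k) * (1 + k)) (Λ-list-large j)) ⟩
  (2 + k) * (8 * x) + (2 + k) * (1 + k) * (8 * y) ≡⟨ regroup (2 + k) (1 + k) x y ⟩
  8 * ((2 + k) * x + (2 + k) * (1 + k) * y)       ≡⟨ cong (8 *_) (Λ-list-length k) ⟨
  8 * length (Λ-list (3 + k))                     ∎
  where
  open ≤-Reasoning
  x = length (Λ-list (2 + k))
  y = length (Λ-list k)
  regroup : ∀ a b u v → a * (8 * u) + a * b * (8 * v) ≡ 8 * (a * u + a * b * v)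
  regroup = solve-∀

lemma4p5 : (n : ℕ) → n ≥ 3 → Σ (List (Permutation′ n)) (λ ps → DistinctInΛ ps × 8 * length ps ≥ n !)
lemma4p5 (suc (suc (suc k))) (s≤s (s≤s (s≤s _))) =
  Λ-list (3 + k) , (Λ-list-Unique (3 + k) , Λ-list-NoShortOrbit (3 + k)) , Λ-list-large k
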